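{- Let $\mathcal F$ be a group pair with $A$ as in the context, and suppose $A$ is closed under relational converse and relational composition. Then for all $(x,y),(y,z)\in\mathcal E$, $$\varphi_{xy}[H_{xy}\circ H_{xz}]=K_{xy}\circ H_{yz},\quad\varphi_{yz}[K_{xy}\circ H_{yz}]=K_{xz}\circ K_{yz},\quad\varphi_{xz}[H_{xy}\circ H_{xz}]=K_{xz}\circ K_{yz}.$$ In other words: (i) the map induced by $\varphi_{xy}$ maps $G_x/(H_{xy}\circ H_{xz})$ isomorphically onto $G_y/(K_{xy}\circ H_{yz})$; (ii) the map induced by $\varphi_{yz}$ maps $G_y/(K_{xy}\circ H_{yz})$ isomorphically onto $G_z/(K_{xz}\circ K_{yz})$; (iii) the map induced by $\varphi_{xz}$ maps $G_x/(H_{xy}\circ H_{xz})$ isomorphically onto $G_z/(K_{xz}\circ K_{yz})$.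
   Context: A group pair consists of the following data. - Pairwise disjoint groups $G_x$ ($x\in I$). - An equivalence relation $\mathcal E$ on $I$. - For each $(x,y)\in\mathcal E$, an isomorphism $\varphi_{xy}:G_x/H_{xy}\to G_y/K_{xy}$, where $H_{xy}\trianglelefteq G_x$ and $K_{xy}\trianglelefteq G_y$. $X\circ Y$ denotes the complex product. For each $(x,y)\in\mathcal E$ fix an enumeration without repetitions $\langle H_{xy,\gamma}:\gamma<\kappa_{xy}\rangle$ of the cosets of $H_{xy}$, with $H_{xy,0}=H_{xy}$, and put $K_{xy,\gamma}=\varphi_{xy}(H_{xy,\gamma})$. Define $R_{xy,\alpha}=\bigcup_{\gamma}H_{xy,\gamma}\times(K_{xy,\gamma}\circ K_{xy,\alpha})$, and let $A$ be the set of all unions of subfamilies of these relations. For $S\subseteq G_x$ a union of cosets of $H_{xy}$, $\varphi_{xy}[S]$ is the union of the images of the cosets contained in $S$. The map induced by $\varphi_{xy}$ on a quotient by a normal subgroup $N$ that is a union of cosets of $H_{xy}$ sends each coset $C$ of $N$ to $\varphi_{xy}[C]$. -}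

module Defs where

open import Level using (Level; suc)
open import Algebra.Bundles using (Group)
open import Algebra.Bundles.Raw using (RawGroup)
open import Algebra.Morphism.Structures using (module GroupMorphisms)
open import Data.Product using (Σ; ∃; ∃₂; _×_; _,_)
open import Relation.Binary.Core using (Rel)
open import Relation.Binary.Structures using (IsEquivalence)
open import Relation.Binary.PropositionalEquality using (_≡_)
open import Relation.Unary using (Pred; _∈_)

private variable ℓ : Level

record IsNormalSubgroup (G : Group ℓ ℓ) (N : Pred (Group.Carrier G) ℓ) : Set ℓ where
  open Group G
  field
    resp   : ∀ {a b} → a ≈ b → N a → N b
    ε∈     : N ε
    ∙∈     : ∀ {a b} → N a → N b → N (a ∙ b)
    ⁻¹∈    : ∀ {a} → N a → N (a ⁻¹)
    normal : ∀ g {n} → N n → N (g ∙ n ∙ g ⁻¹)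

SameCoset : (G : Group ℓ ℓ) (N : Pred (Group.Carrier G) ℓ) → Rel (Group.Carrier G) ℓ
SameCoset G N a b = N (a ⁻¹ ∙ b)
  where open Group G

Coset : (G : Group ℓ ℓ) (N : Pred (Group.Carrier G) ℓ) → Group.Carrier G → Pred (Group.Carrier G) ℓ
Coset G N c g = SameCoset G N c g

-- The quotient group G/N as a raw group: same carrier and operations,
-- equality is "same coset" (no quotient types in Agda).
Quotient : (G : Group ℓ ℓ) (N : Pred (Group.Carrier G) ℓ) → RawGroup ℓ ℓ
Quotient G N = record
  { Carrier = Carrier
  ; _≈_     = SameCoset G N
  ; _∙_     = _∙_
  ; ε       = ε
  ; _⁻¹     = _⁻¹
  }
  where open Group G

ComplexProduct : (G : Group ℓ ℓ) → Pred (Group.Carrier G) ℓ → Pred (Group.Carrier G) ℓ → Pred (Group.Carrier G) ℓ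
ComplexProduct G X Y g = ∃₂ λ a b → X a × Y b × (g ≈ a ∙ b)
  where open Group G

record GroupPair ℓ : Set (suc ℓ) where
  field
    I       : Set ℓ
    G       : I → Group ℓ ℓ
    E       : Rel I ℓ
    E-equiv : IsEquivalence E
    -- E is a relation (a set of pairs): membership proofs are unique,
    -- so the data below are indexed by the pair (x , y) only.
    E-prop  : ∀ {x y} (p q : E x y) → p ≡ q
    H       : ∀ {x y} → E x y → Pred (Group.Carrier (G x)) ℓ
    K       : ∀ {x y} → E x y → Pred (Group.Carrier (G y)) ℓ
    H-normal : ∀ {x y} (e : E x y) → IsNormalSubgroup (G x) (H e)
    K-normal : ∀ {x y} (e : E x y) → IsNormalSubgroup (G y) (K e)
    -- φ_xy : G_x/H_xy → G_y/K_xy, given on representatives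
    φ       : ∀ {x y} → E x y → Group.Carrier (G x) → Group.Carrier (G y)
    φ-iso   : ∀ {x y} (e : E x y) →
              GroupMorphisms.IsGroupIsomorphism (Quotient (G x) (H e)) (Quotient (G y) (K e)) (φ e)

module _ (𝓕 : GroupPair ℓ) where
  open GroupPair 𝓕

  U : Set ℓ
  U = Σ I λ x → Group.Carrier (G x)

  -- φ_xy[S] for S ⊆ G_x: the union of the images φ_xy(gH_xy) for g ∈ S,
  -- i.e. the set of h ∈ G_y lying in the coset φ_xy(gH_xy) for some g ∈ S.
  Image : ∀ {x y} (e : E x y) → Pred (Group.Carrier (G x)) ℓ → Pred (Group.Carrier (G y)) ℓ
  Image {y = y} e S h = ∃ λ g → S g × SameCoset (G y) (K e) (φ e g) h

  -- R_{xy,α} where the H_xy-coset H_{xy,α} = a H_xy is given by a representative a: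
  -- R = ⋃_γ H_{xy,γ} × (K_{xy,γ} ∘ K_{xy,α}), with K_{xy,γ} = φ_xy[H_{xy,γ}],
  -- the cosets H_{xy,γ} = c H_xy being indexed by representatives c.
  data R {x y} (e : E x y) (a : Group.Carrier (G x)) : U → U → Set ℓ where
    r : (g : Group.Carrier (G x)) (h : Group.Carrier (G y)) (c : Group.Carrier (G x)) →
        Coset (G x) (H e) c g →
        ComplexProduct (G y) (Image e (Coset (G x) (H e) c)) (Image e (Coset (G x) (H e) a)) h →
        R e a (x , g) (y , h)

  Idx : Set ℓ
  Idx = Σ I λ x → Σ I λ y → Σ (E x y) λ _ → Group.Carrier (G x)

  RIdx : Idx → U → U → Set ℓ
  RIdx (x , y , e , a) = R e a

  -- S ∈ A : S is the union of a subfamily of the R_{xy,α}.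
  InA : (U → U → Set ℓ) → Set (suc ℓ)
  InA S = Σ (Idx → Set ℓ) λ F →
            ∀ u v → (S u v → ∃ λ i → F i × RIdx i u v) × ((∃ λ i → F i × RIdx i u v) → S u v)

  Converse : (U → U → Set ℓ) → U → U → Set ℓ
  Converse S u v = S v u

  Compose : (U → U → Set ℓ) → (U → U → Set ℓ) → U → U → Set ℓ
  Compose S T u w = ∃ λ v → S u v × T v w

  AClosed : Set (suc ℓ)
  AClosed = (∀ S → InA S → InA (Converse S))
          × (∀ S T → InA S → InA T → InA (Compose S T))

module Submission where

-- Write  g ▷ h  ("φ_xy sends g to h") for  φ_xy(g) ≡ h  mod K_xy.
-- Unfolding the definition, R_{xy,α} (with α the coset of a) relates g to h exactly
-- when  (g ∙ a) ▷ h;  in particular R_{xy,0} is the graph of ▷.  If a union T of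
-- relations R_{xy,α} relates ε to ε, the relation R_{xy,α} witnessing this has
-- φ_xy(a) ∈ K_xy, hence contains the whole graph of φ_xy ("graph saturation").
-- Closure of A under converse and composition makes the composites
-- R_xy;R_yz,  R_xz;R_yz˘  and  R_xy˘;R_xz  members of A relating ε to ε, so the three
-- graphs form a "commuting triangle": any pair related by one of φ_xy, φ_yz, φ_xz
-- factors through the third group.  Specialising to ε moves kernel elements between
-- the groups, and chasing cosets around the triangle gives the six inclusions.

open import Defs
open import Level using (Level)
open import Data.Product using (_×_; ∃; _,_; proj₁; proj₂)
open import Relation.Unary using (Pred; _⊆_; _≐_)
open import Relation.Binary.Core using (Rel)
open import Relation.Binary.PropositionalEquality using (_≡_; refl)
open import Algebra.Bundles using (Group)
open import Algebra.Morphism.Structures using (module GroupMorphisms)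
import Algebra.Properties.Group as GroupProperties
import Relation.Binary.Reasoning.Setoid as SetoidReasoning

module Cosets {ℓ : Level} {G : Group ℓ ℓ} {N : Pred (Group.Carrier G) ℓ}
              (isN : IsNormalSubgroup G N) where
  open Group G
  open GroupProperties G
  open IsNormalSubgroup isN public using (ε∈)
  open IsNormalSubgroup isN using (resp; ∙∈; ⁻¹∈; normal)
  open SetoidReasoning setoid

  infix 4 _~_
  _~_ : Rel Carrier ℓ
  _~_ = SameCoset G N

  ~-refl : ∀ {a} → a ~ a
  ~-refl {a} = resp (sym (inverseˡ a)) ε∈

  ~-sym : ∀ {a b} → a ~ b → b ~ a
  ~-sym {a} {b} p = resp (⁻¹-anti-homo-\\ a b) (⁻¹∈ p)

  ~-trans : ∀ {a b c} → a ~ b → b ~ c → a ~ c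
  ~-trans {a} {b} {c} p q = resp (trans (assoc _ _ _) (∙-congˡ (\\-leftDividesˡ b c))) (∙∈ p q)

  ≈⇒~ : ∀ {a b} → a ≈ b → a ~ b
  ≈⇒~ {a} a≈b = resp (∙-congˡ a≈b) (~-refl {a})

  ∙-congˡ~ : ∀ {a b b′} → b ~ b′ → a ∙ b ~ a ∙ b′
  ∙-congˡ~ {a} {b} {b′} p = resp (sym cancel) p
    where
    cancel : (a ∙ b) ⁻¹ ∙ (a ∙ b′) ≈ b ⁻¹ ∙ b′
    cancel = begin
      (a ∙ b) ⁻¹ ∙ (a ∙ b′)     ≈⟨ ∙-congʳ (⁻¹-anti-homo-∙ a b) ⟩
      (b ⁻¹ ∙ a ⁻¹) ∙ (a ∙ b′)  ≈⟨ assoc _ _ _ ⟩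
      b ⁻¹ ∙ (a ⁻¹ ∙ (a ∙ b′))  ≈⟨ ∙-congˡ (\\-leftDividesʳ a b′) ⟩
      b ⁻¹ ∙ b′                 ∎

  -- Right multiplication respects cosets because N is normal.
  ∙-congʳ~ : ∀ {a a′ b} → a ~ a′ → a ∙ b ~ a′ ∙ b
  ∙-congʳ~ {a} {a′} {b} p = resp conjugate (normal (b ⁻¹) p)
    where
    conjugate : b ⁻¹ ∙ (a ⁻¹ ∙ a′) ∙ b ⁻¹ ⁻¹ ≈ (a ∙ b) ⁻¹ ∙ (a′ ∙ b)
    conjugate = begin
      b ⁻¹ ∙ (a ⁻¹ ∙ a′) ∙ b ⁻¹ ⁻¹  ≈⟨ ∙-congˡ (⁻¹-involutive b) ⟩
      b ⁻¹ ∙ (a ⁻¹ ∙ a′) ∙ b        ≈⟨ ∙-congʳ (sym (assoc _ _ _)) ⟩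
      (b ⁻¹ ∙ a ⁻¹) ∙ a′ ∙ b        ≈⟨ ∙-congʳ (∙-congʳ (sym (⁻¹-anti-homo-∙ a b))) ⟩
      (a ∙ b) ⁻¹ ∙ a′ ∙ b           ≈⟨ assoc _ _ _ ⟩
      (a ∙ b) ⁻¹ ∙ (a′ ∙ b)         ∎

  ∙-cong~ : ∀ {a a′ b b′} → a ~ a′ → b ~ b′ → a ∙ b ~ a′ ∙ b′
  ∙-cong~ p q = ~-trans (∙-congʳ~ p) (∙-congˡ~ q)

  private
    ε⁻¹∙a≈a : ∀ a → ε ⁻¹ ∙ a ≈ a
    ε⁻¹∙a≈a a = trans (∙-congʳ ε⁻¹≈ε) (identityˡ a)

  ∈⇒ε~ : ∀ {a} → N a → ε ~ a
  ∈⇒ε~ {a} n = resp (sym (ε⁻¹∙a≈a a)) n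

  ε~⇒∈ : ∀ {a} → ε ~ a → N a
  ε~⇒∈ {a} p = resp (ε⁻¹∙a≈a a) p

  ~-rightFactor : ∀ {a b c} → N a → c ≈ a ∙ b → c ~ b
  ~-rightFactor {b = b} n c≈ab =
    ~-trans (≈⇒~ c≈ab) (~-trans (∙-congʳ~ (~-sym (∈⇒ε~ n))) (≈⇒~ (identityˡ b)))

  ~-leftFactor : ∀ {a b c} → N b → c ≈ a ∙ b → c ~ a
  ~-leftFactor {a} n c≈ab =
    ~-trans (≈⇒~ c≈ab) (~-trans (∙-congˡ~ (~-sym (∈⇒ε~ n))) (≈⇒~ (identityʳ a)))

-- Membership criterion for complex products: if b ∈ N and a lies in the
-- M-coset of b, then a = b ∙ (b⁻¹ ∙ a) ∈ N ∘ M.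
complexProduct-intro : ∀ {ℓ} (G : Group ℓ ℓ) {N M : Pred (Group.Carrier G) ℓ} {a b} →
                       N b → SameCoset G M b a → ComplexProduct G N M a
complexProduct-intro G {a = a} {b} n m =
  b , b ⁻¹ ∙ a , n , m , sym (\\-leftDividesˡ b a)
  where
  open Group G
  open GroupProperties G

module QuotientIsomorphism
  {ℓ : Level} {G₁ G₂ : Group ℓ ℓ}
  {H : Pred (Group.Carrier G₁) ℓ} {K : Pred (Group.Carrier G₂) ℓ}
  (isH : IsNormalSubgroup G₁ H) (isK : IsNormalSubgroup G₂ K)
  {f : Group.Carrier G₁ → Group.Carrier G₂}
  (iso : GroupMorphisms.IsGroupIsomorphism (Quotient G₁ H) (Quotient G₂ K) f) where
  module Dom = Cosets isH
  module Cod = Cosets isK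
  private
    module G₁ = Group G₁
    module G₂ = Group G₂
  open GroupMorphisms.IsGroupIsomorphism iso using (⟦⟧-cong; ∙-homo; ε-homo; injective)
  open GroupProperties G₂ using (\\-leftDividesʳ)

  infix 4 _▷_
  _▷_ : Group.Carrier G₁ → Group.Carrier G₂ → Set ℓ
  g ▷ h = f g Cod.~ h

  ▷-image : ∀ {g} → g ▷ f g
  ▷-image = Cod.~-refl

  ▷-ε : G₁.ε ▷ G₂.ε
  ▷-ε = ε-homo

  ▷-respˡ : ∀ {g g′ h} → g Dom.~ g′ → g ▷ h → g′ ▷ h
  ▷-respˡ p q = Cod.~-trans (Cod.~-sym (⟦⟧-cong p)) q

  ▷-respʳ : ∀ {g h h′} → g ▷ h → h Cod.~ h′ → g ▷ h′
  ▷-respʳ = Cod.~-trans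

  ▷-functional : ∀ {g h h′} → g ▷ h → g ▷ h′ → h Cod.~ h′
  ▷-functional p q = Cod.~-trans (Cod.~-sym p) q

  ▷-injective : ∀ {g g′ h} → g ▷ h → g′ ▷ h → g Dom.~ g′
  ▷-injective p q = injective (Cod.~-trans p (Cod.~-sym q))

  ▷-∙ : ∀ {g g′ h h′} → g ▷ h → g′ ▷ h′ → (g G₁.∙ g′) ▷ (h G₂.∙ h′)
  ▷-∙ {g} {g′} p q = Cod.~-trans (∙-homo g g′) (Cod.∙-cong~ p q)

  ▷-cancelˡ : ∀ {g a h} → (g G₁.∙ a) ▷ h → a ▷ (f g G₂.⁻¹ G₂.∙ h)
  ▷-cancelˡ {g} {a} p =
    Cod.~-trans (Cod.≈⇒~ (G₂.sym (\\-leftDividesʳ (f g) (f a))))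
      (Cod.∙-congˡ~ (Cod.~-trans (Cod.~-sym (∙-homo g a)) p))

  ε▷kernel : ∀ {h} → K h → G₁.ε ▷ h
  ε▷kernel k = ▷-respʳ ▷-ε (Cod.∈⇒ε~ k)

  ▷-preserves-kernel : ∀ {g h} → H g → g ▷ h → K h
  ▷-preserves-kernel n p =
    Cod.ε~⇒∈ (▷-functional ▷-ε (▷-respˡ (Dom.~-sym (Dom.∈⇒ε~ n)) p))

  ▷-reflects-kernel : ∀ {g h} → K h → g ▷ h → H g
  ▷-reflects-kernel k p = Dom.ε~⇒∈ (▷-injective (ε▷kernel k) p)

module _ {ℓ : Level} (𝓕 : GroupPair ℓ) where
  open GroupPair 𝓕

  module Φ {x y} (e : E x y) = QuotientIsomorphism (H-normal e) (K-normal e) (φ-iso e)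

  Graph : ∀ {x y} → E x y → U 𝓕 → U 𝓕 → Set ℓ
  Graph {x} e = R 𝓕 e (Group.ε (G x))

  module _ {x y} (e : E x y) where
    open Φ e
    private
      module GX = Group (G x)
      module GY = Group (G y)

    R-sound : ∀ {a g h} → R 𝓕 e a (x , g) (y , h) → (g GX.∙ a) ▷ h
    R-sound (r _ _ c c~g (u , v , (g₁ , c~g₁ , g₁▷u) , (g₂ , a~g₂ , g₂▷v) , h≈uv)) =
      ▷-respʳ (▷-respˡ (Dom.∙-cong~ (Dom.~-trans (Dom.~-sym c~g₁) c~g) (Dom.~-sym a~g₂))
                       (▷-∙ g₁▷u g₂▷v))
              (Cod.≈⇒~ (GY.sym h≈uv))

    R-complete : ∀ {a g h} → (g GX.∙ a) ▷ h → R 𝓕 e a (x , g) (y , h)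
    R-complete {a} {g} {h} p =
      r g h g Dom.~-refl
        ( φ e g , φ e g GY.⁻¹ GY.∙ h
        , (g , Dom.~-refl , ▷-image) , (a , Dom.~-refl , ▷-cancelˡ p)
        , GY.sym (GroupProperties.\\-leftDividesˡ (G y) (φ e g) h))

    graph-sound : ∀ {g h} → Graph e (x , g) (y , h) → g ▷ h
    graph-sound ρ = ▷-respˡ (Dom.≈⇒~ (GX.identityʳ _)) (R-sound ρ)

    graph-complete : ∀ {g h} → g ▷ h → Graph e (x , g) (y , h)
    graph-complete p = R-complete (▷-respˡ (Dom.≈⇒~ (GX.sym (GX.identityʳ _))) p)

    graph-ε : Graph e (x , GX.ε) (y , GY.ε)
    graph-ε = graph-complete ▷-ε

    R∈A : ∀ a → InA 𝓕 (R 𝓕 e a)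
    R∈A a = (λ i → i ≡ (x , y , e , a))
          , λ u v → (λ s → (x , y , e , a) , refl , s) , λ { (_ , refl , s) → s }

    -- If R_{xy,α} relates ε to ε then φ_xy(α) is trivial and R_{xy,α} contains the graph of φ_xy.
    R-saturated : ∀ (i : Idx 𝓕) {g h} → RIdx 𝓕 i (x , GX.ε) (y , GY.ε) → g ▷ h → RIdx 𝓕 i (x , g) (y , h)
    R-saturated (_ , _ , e′ , a) ρ@(r _ _ _ _ _) p with E-prop e′ e
    ... | refl = R-complete (▷-respˡ (Dom.∙-congˡ~ (Dom.≈⇒~ (GX.identityˡ a)))
                                     (▷-respʳ (▷-∙ p (R-sound ρ)) (Cod.≈⇒~ (GY.identityʳ _))))

    graph-saturation : ∀ T → InA 𝓕 T → T (x , GX.ε) (y , GY.ε) → ∀ {g h} → g ▷ h → T (x , g) (y , h)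
    graph-saturation T (F , T≐⋃F) t₀ p with proj₁ (T≐⋃F _ _) t₀
    ... | i , i∈F , ρ = proj₂ (T≐⋃F _ _) (i , i∈F , R-saturated i ρ p)

module Triangle {ℓ : Level} (𝓕 : GroupPair ℓ) (closed : AClosed 𝓕) {x y z : GroupPair.I 𝓕}
                (exy : GroupPair.E 𝓕 x y) (eyz : GroupPair.E 𝓕 y z) (exz : GroupPair.E 𝓕 x z) where
  open GroupPair 𝓕
  private
    module XY = Φ 𝓕 exy
    module YZ = Φ 𝓕 eyz
    module XZ = Φ 𝓕 exz
    module GX = Group (G x)
    module GY = Group (G y)
    module GZ = Group (G z)
    converse∈A = proj₁ closed
    compose∈A  = proj₂ closed

  Nx : Pred GX.Carrier ℓ
  Nx = ComplexProduct (G x) (H exy) (H exz)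

  Ny : Pred GY.Carrier ℓ
  Ny = ComplexProduct (G y) (K exy) (H eyz)

  Nz : Pred GZ.Carrier ℓ
  Nz = ComplexProduct (G z) (K exz) (K eyz)

  through-y : ∀ {g k} → g XZ.▷ k → ∃ λ h → g XY.▷ h × h YZ.▷ k
  through-y p
    with graph-saturation 𝓕 exz (Compose 𝓕 (Graph 𝓕 exy) (Graph 𝓕 eyz))
           (compose∈A _ _ (R∈A 𝓕 exy _) (R∈A 𝓕 eyz _))
           ((y , GY.ε) , graph-ε 𝓕 exy , graph-ε 𝓕 eyz) p
  ... | (_ , h) , ρ₁@(r _ _ _ _ _) , ρ₂ = h , graph-sound 𝓕 exy ρ₁ , graph-sound 𝓕 eyz ρ₂

  through-z : ∀ {g h} → g XY.▷ h → ∃ λ k → g XZ.▷ k × h YZ.▷ k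
  through-z p
    with graph-saturation 𝓕 exy (Compose 𝓕 (Graph 𝓕 exz) (Converse 𝓕 (Graph 𝓕 eyz)))
           (compose∈A _ _ (R∈A 𝓕 exz _) (converse∈A _ (R∈A 𝓕 eyz _)))
           ((z , GZ.ε) , graph-ε 𝓕 exz , graph-ε 𝓕 eyz) p
  ... | (_ , k) , ρ₁@(r _ _ _ _ _) , ρ₂ = k , graph-sound 𝓕 exz ρ₁ , graph-sound 𝓕 eyz ρ₂

  through-x : ∀ {h k} → h YZ.▷ k → ∃ λ g → g XY.▷ h × g XZ.▷ k
  through-x p
    with graph-saturation 𝓕 eyz (Compose 𝓕 (Converse 𝓕 (Graph 𝓕 exy)) (Graph 𝓕 exz))
           (compose∈A _ _ (converse∈A _ (R∈A 𝓕 exy _)) (R∈A 𝓕 exz _))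
           ((x , GX.ε) , graph-ε 𝓕 exy , graph-ε 𝓕 exz) p
  ... | (_ , g) , ρ₁@(r _ _ _ _ _) , ρ₂ = g , graph-sound 𝓕 exy ρ₁ , graph-sound 𝓕 exz ρ₂

  -- Kernel transfers: the triangle evaluated at ε.
  Kxz-from-Kxy : ∀ {k} → K exz k → ∃ λ h → K exy h × h YZ.▷ k
  Kxz-from-Kxy kK =
    let h , ε▷h , h▷k = through-y (XZ.ε▷kernel kK)
    in  h , XY.▷-preserves-kernel XY.Dom.ε∈ ε▷h , h▷k

  Kxy-to-Kxz : ∀ {h} → K exy h → ∃ λ k → K exz k × h YZ.▷ k
  Kxy-to-Kxz hK =
    let k , ε▷k , h▷k = through-z (XY.ε▷kernel hK)
    in  k , XZ.▷-preserves-kernel XZ.Dom.ε∈ ε▷k , h▷k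

  Kyz-from-Hxy : ∀ {k} → K eyz k → ∃ λ g → H exy g × g XZ.▷ k
  Kyz-from-Hxy kK =
    let g , g▷ε , g▷k = through-x (YZ.ε▷kernel kK)
    in  g , XY.▷-reflects-kernel XY.Cod.ε∈ g▷ε , g▷k

  Kxy-into-Nz : ∀ {h k} → K exy h → h YZ.▷ k → Nz k
  Kxy-into-Nz hK h▷k =
    let k′ , k′K , h▷k′ = Kxy-to-Kxz hK
    in  complexProduct-intro (G z) k′K (YZ.▷-functional h▷k′ h▷k)

  Kxz-preimage-in-Ny : ∀ {h k} → K exz k → h YZ.▷ k → Ny h
  Kxz-preimage-in-Ny kK h▷k =
    let h′ , h′K , h′▷k = Kxz-from-Kxy kK
    in  complexProduct-intro (G y) h′K (YZ.▷-injective h′▷k h▷k)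

  image-xy⊆ : Image 𝓕 exy Nx ⊆ Ny
  image-xy⊆ (g , (a , b , aH , bH , g≈ab) , g▷h) =
    let k , b▷k , h▷k = through-z (XY.▷-respˡ (XY.Dom.~-rightFactor aH g≈ab) g▷h)
    in  Kxz-preimage-in-Ny (XZ.▷-preserves-kernel bH b▷k) h▷k

  image-xy⊇ : Ny ⊆ Image 𝓕 exy Nx
  image-xy⊇ (u , v , uK , vH , h≈uv) =
    let g  , g▷v  , g▷φv  = through-x (YZ.▷-image {v})
        g′ , g′H  , g′▷φv = Kyz-from-Hxy (YZ.▷-preserves-kernel vH YZ.▷-image)
    in  g , complexProduct-intro (G x) g′H (XZ.▷-injective g′▷φv g▷φv)
          , XY.▷-respʳ g▷v (XY.Cod.~-sym (XY.Cod.~-rightFactor uK h≈uv))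

  image-yz⊆ : Image 𝓕 eyz Ny ⊆ Nz
  image-yz⊆ (h , (u , v , uK , vH , h≈uv) , h▷k) =
    Kxy-into-Nz uK (YZ.▷-respˡ (YZ.Dom.~-leftFactor vH h≈uv) h▷k)

  image-yz⊇ : Nz ⊆ Image 𝓕 eyz Ny
  image-yz⊇ (a , b , aK , bK , k≈ab) =
    let h , hK , h▷a = Kxz-from-Kxy aK
    in  h , complexProduct-intro (G y) hK YZ.Dom.~-refl
          , YZ.▷-respʳ h▷a (YZ.Cod.~-sym (YZ.Cod.~-leftFactor bK k≈ab))

  image-xz⊆ : Image 𝓕 exz Nx ⊆ Nz
  image-xz⊆ (g , (a , b , aH , bH , g≈ab) , g▷k) =
    let h , a▷h , h▷k = through-y (XZ.▷-respˡ (XZ.Dom.~-leftFactor bH g≈ab) g▷k)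
    in  Kxy-into-Nz (XY.▷-preserves-kernel aH a▷h) h▷k

  image-xz⊇ : Nz ⊆ Image 𝓕 exz Nx
  image-xz⊇ (a , b , aK , bK , k≈ab) =
    let g , gH , g▷b = Kyz-from-Hxy bK
    in  g , complexProduct-intro (G x) gH XZ.Dom.~-refl
          , XZ.▷-respʳ g▷b (XZ.Cod.~-sym (XZ.Cod.~-rightFactor aK k≈ab))

theorem3p13 : ∀ {ℓ : Level} (𝓕 : GroupPair ℓ) → AClosed 𝓕 →
    ∀ {x y z} (exy : GroupPair.E 𝓕 x y) (eyz : GroupPair.E 𝓕 y z) (exz : GroupPair.E 𝓕 x z) →
      (Image 𝓕 exy (ComplexProduct (GroupPair.G 𝓕 x) (GroupPair.H 𝓕 exy) (GroupPair.H 𝓕 exz))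
        ≐ ComplexProduct (GroupPair.G 𝓕 y) (GroupPair.K 𝓕 exy) (GroupPair.H 𝓕 eyz))
      × (Image 𝓕 eyz (ComplexProduct (GroupPair.G 𝓕 y) (GroupPair.K 𝓕 exy) (GroupPair.H 𝓕 eyz))
        ≐ ComplexProduct (GroupPair.G 𝓕 z) (GroupPair.K 𝓕 exz) (GroupPair.K 𝓕 eyz))
      × (Image 𝓕 exz (ComplexProduct (GroupPair.G 𝓕 x) (GroupPair.H 𝓕 exy) (GroupPair.H 𝓕 exz))
        ≐ ComplexProduct (GroupPair.G 𝓕 z) (GroupPair.K 𝓕 exz) (GroupPair.K 𝓕 eyz))
theorem3p13 𝓕 closed exy eyz exz =
    (image-xy⊆ , image-xy⊇)
  , (image-yz⊆ , image-yz⊇)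
  , (image-xz⊆ , image-xz⊇)
  where open Triangle 𝓕 closed exy eyz exz
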